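{- Let $d\ge 1$. If $S$ is a metric generator of the hypercube $Q_d$, then there is at most one index $i\in\{1,\dots,d\}$ such that all vertices of $S$ have the same value at the $i$-th coordinate.
   Context: The hypercube $Q_d$ has vertex set $\{0,1\}^d$, two vertices adjacent iff they differ in exactly one coordinate; the distance $d(u,v)$ is the number of coordinates in which $u,v$ differ. A set $S$ of vertices is a metric generator if for every two distinct vertices $u,v$ some $s\in S$ has $d(u,s)\ne d(v,s)$. -}

module Defs where

open import Data.Nat using (ℕ; zero; suc)
open import Data.Bool using (Bool; true; false)
open import Data.Fin using (Fin)
open import Data.Vec using (Vec; []; _∷_; lookup)
open import Data.Product using (∃; _×_)
open import Relation.Binary.PropositionalEquality using (_≡_; _≢_)

Vertex : ℕ → Set
Vertex d = Vec Bool d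

diff : Bool → Bool → ℕ
diff false false = 0
diff true  true  = 0
diff false true  = 1
diff true  false = 1

-- Hamming distance = graph distance in Q_d: number of coordinates where u, v differ.
dist : ∀ {d} → Vertex d → Vertex d → ℕ
dist []       []       = 0
dist (x ∷ u) (y ∷ v) = diff x y Data.Nat.+ dist u v

IsMetricGenerator : ∀ {d} → (Vertex d → Set) → Set
IsMetricGenerator {d} S =
  ∀ (u v : Vertex d) → u ≢ v → ∃ λ s → S s × dist u s ≢ dist v s

ConstantAt : ∀ {d} → (Vertex d → Set) → Fin d → Set
ConstantAt {d} S i = ∃ λ (b : Bool) → ∀ (s : Vertex d) → S s → lookup s i ≡ b

-- If every vertex of S agrees with a vertex t at the coordinates i ≠ j, then flipping
-- t at i or at j moves it one step further from every vertex of S; the two flips are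
-- distinct vertices that S does not resolve.
module Submission where

open import Defs
open import Data.Nat using (ℕ; _≥_; _+_; suc)
open import Data.Nat.Properties using (+-suc)
open import Data.Bool using (Bool; true; false; not)
open import Data.Bool.Properties using (not-¬)
open import Data.Fin using (Fin; _≟_) renaming (zero to fzero; suc to fsuc)
open import Data.Vec using (_∷_; lookup; replicate; updateAt; _[_]≔_)
open import Data.Vec.Properties using (lookup∘updateAt; lookup∘updateAt′; lookup∘update; lookup∘update′)
open import Data.Product using (∃; _×_; _,_)
open import Relation.Nullary using (yes; no; contradiction)
open import Relation.Binary.PropositionalEquality
  using (_≡_; _≢_; refl; sym; trans; cong; module ≡-Reasoning)

flip : ∀ {d} → Fin d → Vertex d → Vertex d
flip k u = updateAt u k not

diff-not-self : ∀ b → diff (not b) b ≡ suc (diff b b)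
diff-not-self false = refl
diff-not-self true  = refl

dist-flip : ∀ {d} (k : Fin d) (u s : Vertex d) →
  lookup u k ≡ lookup s k → dist (flip k u) s ≡ suc (dist u s)
dist-flip fzero    (x ∷ u) (.x ∷ s) refl = cong (_+ dist u s) (diff-not-self x)
dist-flip (fsuc k) (x ∷ u) (y ∷ s) uₖ≡sₖ = begin
  diff x y + dist (flip k u) s  ≡⟨ cong (diff x y +_) (dist-flip k u s uₖ≡sₖ) ⟩
  diff x y + suc (dist u s)     ≡⟨ +-suc (diff x y) (dist u s) ⟩
  suc (diff x y + dist u s)     ∎
  where open ≡-Reasoning

flip-distinct : ∀ {d} {i j : Fin d} → i ≢ j → (t : Vertex d) → flip i t ≢ flip j t
flip-distinct {i = i} {j} i≢j t flipᵢ≡flipⱼ =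
  not-¬ refl (trans (sym flipᵢ-keeps-i) (lookup∘updateAt i t))
  where
  open ≡-Reasoning
  flipᵢ-keeps-i : lookup (flip i t) i ≡ lookup t i
  flipᵢ-keeps-i = begin
    lookup (flip i t) i  ≡⟨ cong (λ u → lookup u i) flipᵢ≡flipⱼ ⟩
    lookup (flip j t) i  ≡⟨ lookup∘updateAt′ i j i≢j t ⟩
    lookup t i           ∎

vertex-with-values : ∀ {d} {i j : Fin d} → i ≢ j → (bᵢ bⱼ : Bool) →
  ∃ λ (t : Vertex d) → lookup t i ≡ bᵢ × lookup t j ≡ bⱼ
vertex-with-values {d} {i} {j} i≢j bᵢ bⱼ =
    zeros [ i ]≔ bᵢ [ j ]≔ bⱼ
  , trans (lookup∘update′ i≢j (zeros [ i ]≔ bᵢ) bⱼ) (lookup∘update i zeros bᵢ)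
  , lookup∘update j (zeros [ i ]≔ bᵢ) bⱼ
  where
  zeros : Vertex d
  zeros = replicate d false

lemma6 : (d : ℕ) → d ≥ 1 → (S : Vertex d → Set) → IsMetricGenerator S →
    (i j : Fin d) → ConstantAt S i → ConstantAt S j → i ≡ j
lemma6 d _ S resolves i j (bᵢ , Sᵢ≡bᵢ) (bⱼ , Sⱼ≡bⱼ) with i ≟ j
... | yes i≡j = i≡j
... | no i≢j  with vertex-with-values i≢j bᵢ bⱼ
...   | t , tᵢ≡bᵢ , tⱼ≡bⱼ with resolves (flip i t) (flip j t) (flip-distinct i≢j t)
...     | s , s∈S , unequal = contradiction equidistant unequal
  where
  equidistant : dist (flip i t) s ≡ dist (flip j t) s
  equidistant = trans (dist-flip i t s (trans tᵢ≡bᵢ (sym (Sᵢ≡bᵢ s s∈S))))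
                      (sym (dist-flip j t s (trans tⱼ≡bⱼ (sym (Sⱼ≡bⱼ s s∈S)))))
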